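{- Consider the generating series \begin{equation} \sum_{n \geq 0} Z_n t^n = \frac{\sum_{k=0}^{d} h_{k} t^{k} }{\prod_{\ell=0}^{d}(1-q^{\ell} t)}, \end{equation} where $h_k$ are arbitrary coefficients. Then the $Z_n$ are the values at $[n]_q$ of the polynomial \begin{equation} \sum_{k=0}^{d} h_k \frac{\prod_{j=d-k-d+1}^{d-k} \left([j]_q + q^j x\right)}{[d]_q!} = \sum_{k=0}^{d} h_k \frac{\prod_{j=1-k}^{d-k} \left([j]_q + q^j x\right)}{[d]_q!}. \end{equation}
   Context: Here $q$ is an indeterminate, $[j]_q = (q^j-1)/(q-1)$ for $j\in\mathbb{Z}$ (a Laurent polynomial for $j<0$), and $[d]_q!$ is the $q$-factorial. For integers $a,b$, the polynomial $\prod_{j=a-b+1}^{a}([j]_q + q^j x)/[b]_q!$ in $x$ evaluates at $x=[n]_q$ to the standard $q$-binomial coefficient $\binom{a+n}{b}_q$. -}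

module Defs where

open import Level using (Level)
open import Algebra.Bundles using (CommutativeRing)
open import Data.Nat using (ℕ; zero; suc; _∸_; _≤ᵇ_)
open import Data.Integer using (ℤ; +_; -[1+_])
open import Data.List using (List; []; _∷_)
open import Data.Bool using (if_then_else_)

-- Everything is relative to a commutative ring R, an element q of R and
-- a chosen inverse qinv of q (needed for the Laurent polynomials [j]_q, q^j, j < 0).
module QArith {c ℓ : Level} (R : CommutativeRing c ℓ) (q qinv : CommutativeRing.Carrier R) where
  open CommutativeRing R

  pow : Carrier → ℕ → Carrier
  pow a zero    = 1#
  pow a (suc n) = a * pow a n

  sumR : ℕ → (ℕ → Carrier) → Carrier
  sumR zero    f = 0#
  sumR (suc n) f = sumR n f + f n

  prodR : ℕ → (ℕ → Carrier) → Carrier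
  prodR zero    f = 1#
  prodR (suc n) f = prodR n f * f n

  qpow : ℤ → Carrier
  qpow (+ n)     = pow q n
  qpow -[1+ n ]  = pow qinv (suc n)

  -- [j]_q = (q^j - 1)/(q - 1) as a Laurent polynomial:
  --   [m]_q  = 1 + q + ... + q^(m-1)              (m ≥ 0)
  --   [-m]_q = -(q^(-1) + q^(-2) + ... + q^(-m))   (m ≥ 1)
  qint : ℤ → Carrier
  qint (+ n)    = sumR n (λ i → pow q i)
  qint -[1+ n ] = - sumR (suc n) (λ i → pow qinv (suc i))

  qfact : ℕ → Carrier
  qfact d = prodR d (λ i → qint (+ suc i))

  -- Polynomials in t as coefficient lists (constant term first)
  Poly : Set c
  Poly = List Carrier

  coeff : Poly → ℕ → Carrier
  coeff []       _       = 0#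
  coeff (a ∷ p)  zero    = a
  coeff (a ∷ p)  (suc n) = coeff p n

  _+P_ : Poly → Poly → Poly
  []      +P p       = p
  (a ∷ p) +P []      = a ∷ p
  (a ∷ p) +P (b ∷ r) = (a + b) ∷ (p +P r)

  scaleP : Carrier → Poly → Poly
  scaleP a []      = []
  scaleP a (b ∷ p) = (a * b) ∷ scaleP a p

  _*P_ : Poly → Poly → Poly
  []      *P r = []
  (a ∷ p) *P r = scaleP a r +P (0# ∷ (p *P r))

  denom : ℕ → Poly
  denom zero    = 1# ∷ (- 1#) ∷ []
  denom (suc d) = denom d *P (1# ∷ (- pow q (suc d)) ∷ [])

  numCoeff : ℕ → (ℕ → Carrier) → ℕ → Carrier
  numCoeff d h n = if n ≤ᵇ d then h n else 0#

  seriesTimesPoly : Poly → (ℕ → Carrier) → ℕ → Carrier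
  seriesTimesPoly P Z n = sumR (suc n) (λ i → coeff P i * Z (n ∸ i))

  qnat : ℕ → Carrier
  qnat n = qint (+ n)

-- Since [a] + q^a [m] = [a + m] for every integer a, the factor [i+1-k] + q^(i+1-k) [n] is
-- [n-k+i+1]: for n ≥ k the k-th product is rising d (n-k) = [n-k+1] ⋯ [n-k+d], and for
-- n < k ≤ d it contains the factor [0] = 0.  As a series in t it is therefore t^k ∑_r rising d r t^r,
-- and since rising d r = [d]! binom(r+d, d)_q, the q-binomial series (proved by induction on d)
-- turns its product with the denominator into [d]! t^k.  So the proposed Z satisfies the
-- recurrence, and it is the only solution because the denominator has constant term 1.
module Submission where

open import Defs
open import Level using (Level)
open import Algebra.Bundles using (CommutativeRing)
open import Data.Nat using (ℕ; suc)
open import Data.Integer using (_⊖_)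

open import Data.Nat as ℕ using (zero; _∸_; _≤_; _<_; _≤ᵇ_; _≤?_; s≤s)
import Data.Nat.Properties as ℕ
open import Data.Nat.Induction using (<-rec)
open import Data.Integer as ℤ using (+_)
import Data.Integer.Properties as ℤ
open import Data.List using ([]; _∷_)
open import Data.Bool using (true; false; T)
open import Data.Unit using (tt)
open import Data.Empty using (⊥-elim)
open import Data.Sum using (inj₁; inj₂)
open import Relation.Nullary using (yes; no)
open import Relation.Binary.PropositionalEquality as ≡ using (_≡_; _≢_)

⊖-balance : ∀ {m j k r} → m ℕ.+ j ≡ k ℕ.+ r → j ⊖ k ≡ r ⊖ m
⊖-balance {m} {j} {k} {r} eq = begin
  j ⊖ k                     ≡⟨ ℤ.+-cancelˡ-⊖ m j k ⟨
  (m ℕ.+ j) ⊖ (m ℕ.+ k)     ≡⟨ ≡.cong₂ _⊖_ eq (ℕ.+-comm m k) ⟩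
  (k ℕ.+ r) ⊖ (k ℕ.+ m)     ≡⟨ ℤ.+-cancelˡ-⊖ k r m ⟩
  r ⊖ m                     ∎
  where open ≡.≡-Reasoning

module _ {c ℓ : Level} (R : CommutativeRing c ℓ) (q qinv : CommutativeRing.Carrier R) where
  open CommutativeRing R hiding (zero)
  open QArith R q qinv
  open import Algebra.Properties.Ring ring using (-1*x≈-x; -‿distribˡ-*)
  open import Algebra.Properties.AbelianGroup +-abelianGroup using (∙-cancelʳ)
  open import Algebra.Properties.CommutativeSemigroup +-commutativeSemigroup
    using () renaming (interchange to +-interchange)
  open import Algebra.Properties.CommutativeSemigroup *-commutativeSemigroup
    using (x∙yz≈y∙xz) renaming (interchange to *-interchange)
  open import Relation.Binary.Reasoning.Setoid setoid

  sumR-cong : ∀ n {f g : ℕ → Carrier} → (∀ i → i < n → f i ≈ g i) → sumR n f ≈ sumR n g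
  sumR-cong zero    f≈g = refl
  sumR-cong (suc n) f≈g = +-cong (sumR-cong n λ i i<n → f≈g i (ℕ.m<n⇒m<1+n i<n)) (f≈g n (ℕ.n<1+n n))

  sumR-zero : ∀ n {f : ℕ → Carrier} → (∀ i → i < n → f i ≈ 0#) → sumR n f ≈ 0#
  sumR-zero zero    f≈0 = refl
  sumR-zero (suc n) f≈0 =
    trans (+-cong (sumR-zero n λ i i<n → f≈0 i (ℕ.m<n⇒m<1+n i<n)) (f≈0 n (ℕ.n<1+n n))) (+-identityʳ 0#)

  sumR-+ : ∀ n (f g : ℕ → Carrier) → sumR n (λ i → f i + g i) ≈ sumR n f + sumR n g
  sumR-+ zero    f g = sym (+-identityʳ 0#)
  sumR-+ (suc n) f g = trans (+-cong (sumR-+ n f g) refl) (+-interchange _ _ _ _)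

  sumR-*ˡ : ∀ n a (f : ℕ → Carrier) → sumR n (λ i → a * f i) ≈ a * sumR n f
  sumR-*ˡ zero    a f = sym (zeroʳ a)
  sumR-*ˡ (suc n) a f = trans (+-cong (sumR-*ˡ n a f) refl) (sym (distribˡ a _ _))

  sumR-sucˡ : ∀ n (f : ℕ → Carrier) → sumR (suc n) f ≈ f 0 + sumR n (λ i → f (suc i))
  sumR-sucˡ zero    f = +-comm _ _
  sumR-sucˡ (suc n) f = trans (+-cong (sumR-sucˡ n f) refl) (+-assoc _ _ _)

  sumR-comm : ∀ m n (F : ℕ → ℕ → Carrier) →
              sumR m (λ i → sumR n (F i)) ≈ sumR n (λ k → sumR m (λ i → F i k))
  sumR-comm zero    n F = sym (sumR-zero n λ _ _ → refl)
  sumR-comm (suc m) n F = trans (+-cong (sumR-comm m n F) refl) (sym (sumR-+ n _ _))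

  prodR-cong : ∀ n {f g : ℕ → Carrier} → (∀ i → i < n → f i ≈ g i) → prodR n f ≈ prodR n g
  prodR-cong zero    f≈g = refl
  prodR-cong (suc n) f≈g = *-cong (prodR-cong n λ i i<n → f≈g i (ℕ.m<n⇒m<1+n i<n)) (f≈g n (ℕ.n<1+n n))

  prodR-zero : ∀ n {f : ℕ → Carrier} i → i < n → f i ≈ 0# → prodR n f ≈ 0#
  prodR-zero (suc n) i (s≤s i≤n) fi≈0 with ℕ.m≤n⇒m<n∨m≡n i≤n
  ... | inj₁ i<n     = trans (*-cong (prodR-zero n i i<n fi≈0) refl) (zeroˡ _)
  ... | inj₂ ≡.refl  = trans (*-cong refl fi≈0) (zeroʳ _)

  prodR-sucˡ : ∀ n (f : ℕ → Carrier) → prodR (suc n) f ≈ f 0 * prodR n (λ i → f (suc i))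
  prodR-sucˡ zero    f = *-comm _ _
  prodR-sucˡ (suc n) f = trans (*-cong (prodR-sucˡ n f) refl) (*-assoc _ _ _)

  Series : Set c
  Series = ℕ → Carrier

  infixl 7 _⋆_
  _⋆_ : Series → Series → Series
  (a ⋆ b) n = sumR (suc n) (λ i → a i * b (n ∸ i))

  δ₀ : Series
  δ₀ zero    = 1#
  δ₀ (suc n) = 0#

  shift : ℕ → Series → Series
  shift zero    a n       = a n
  shift (suc k) a zero    = 0#
  shift (suc k) a (suc n) = shift k a n

  shift-+ : ∀ k a r → shift k a (k ℕ.+ r) ≡ a r
  shift-+ zero    a r = ≡.refl
  shift-+ (suc k) a r = shift-+ k a r

  shift-< : ∀ {n k} a → n < k → shift k a n ≡ 0#
  shift-< {zero}  {suc k} a _         = ≡.refl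
  shift-< {suc n} {suc k} a (s≤s n<k) = shift-< a n<k

  shift-*ˡ : ∀ {a b : Series} x → (∀ r → a r ≈ x * b r) → ∀ k n → shift k a n ≈ x * shift k b n
  shift-*ˡ x a≈xb zero    n       = a≈xb n
  shift-*ˡ x a≈xb (suc k) zero    = sym (zeroʳ x)
  shift-*ˡ x a≈xb (suc k) (suc n) = shift-*ˡ x a≈xb k n

  shift-δ₀-diag : ∀ n → shift n δ₀ n ≡ 1#
  shift-δ₀-diag zero    = ≡.refl
  shift-δ₀-diag (suc n) = shift-δ₀-diag n

  shift-δ₀-≢ : ∀ {n k} → n ≢ k → shift k δ₀ n ≡ 0#
  shift-δ₀-≢ {zero}  {zero}  n≢k = ⊥-elim (n≢k ≡.refl)
  shift-δ₀-≢ {zero}  {suc k} n≢k = ≡.refl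
  shift-δ₀-≢ {suc n} {zero}  n≢k = ≡.refl
  shift-δ₀-≢ {suc n} {suc k} n≢k = shift-δ₀-≢ (λ n≡k → n≢k (≡.cong suc n≡k))

  ⋆-cong : ∀ {a a' b b' : Series} → (∀ i → a i ≈ a' i) → (∀ r → b r ≈ b' r) →
           ∀ n → (a ⋆ b) n ≈ (a' ⋆ b') n
  ⋆-cong a≈a' b≈b' n = sumR-cong (suc n) λ i _ → *-cong (a≈a' i) (b≈b' (n ∸ i))

  ⋆-linearˡ : ∀ (a b : Series) x (e : Series) n →
              ((λ i → a i + x * b i) ⋆ e) n ≈ (a ⋆ e) n + x * (b ⋆ e) n
  ⋆-linearˡ a b x e n = begin
    sumR (suc n) (λ i → (a i + x * b i) * e (n ∸ i))
      ≈⟨ sumR-cong (suc n) (λ i _ → distribʳ _ _ _) ⟩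
    sumR (suc n) (λ i → a i * e (n ∸ i) + x * b i * e (n ∸ i))
      ≈⟨ sumR-+ (suc n) _ _ ⟩
    (a ⋆ e) n + sumR (suc n) (λ i → x * b i * e (n ∸ i))
      ≈⟨ +-cong refl (trans (sumR-cong (suc n) λ i _ → *-assoc _ _ _) (sumR-*ˡ (suc n) x _)) ⟩
    (a ⋆ e) n + x * (b ⋆ e) n ∎

  ⋆-*ʳ : ∀ (e : Series) x (b : Series) n → (e ⋆ (λ r → x * b r)) n ≈ x * (e ⋆ b) n
  ⋆-*ʳ e x b n = trans (sumR-cong (suc n) λ i _ → x∙yz≈y∙xz _ _ _) (sumR-*ˡ (suc n) x _)

  ⋆-linearʳ : ∀ (e a : Series) x (b : Series) n →
              (e ⋆ (λ r → a r + x * b r)) n ≈ (e ⋆ a) n + x * (e ⋆ b) n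
  ⋆-linearʳ e a x b n = begin
    sumR (suc n) (λ i → e i * (a (n ∸ i) + x * b (n ∸ i)))
      ≈⟨ sumR-cong (suc n) (λ i _ → distribˡ _ _ _) ⟩
    sumR (suc n) (λ i → e i * a (n ∸ i) + e i * (x * b (n ∸ i)))
      ≈⟨ sumR-+ (suc n) _ _ ⟩
    (e ⋆ a) n + (e ⋆ (λ r → x * b r)) n
      ≈⟨ +-cong refl (⋆-*ʳ e x b n) ⟩
    (e ⋆ a) n + x * (e ⋆ b) n ∎

  ⋆-sumʳ : ∀ (e : Series) N (x : ℕ → Carrier) (b : ℕ → Series) n →
           (e ⋆ (λ r → sumR N (λ k → x k * b k r))) n ≈ sumR N (λ k → x k * (e ⋆ b k) n)
  ⋆-sumʳ e N x b n = begin
    sumR (suc n) (λ i → e i * sumR N (λ k → x k * b k (n ∸ i)))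
      ≈⟨ sumR-cong (suc n) (λ i _ → trans (sym (sumR-*ˡ N (e i) _)) (sumR-cong N λ k _ → x∙yz≈y∙xz _ _ _)) ⟩
    sumR (suc n) (λ i → sumR N (λ k → x k * (e i * b k (n ∸ i))))
      ≈⟨ sumR-comm (suc n) N _ ⟩
    sumR N (λ k → sumR (suc n) (λ i → x k * (e i * b k (n ∸ i))))
      ≈⟨ sumR-cong N (λ k _ → sumR-*ˡ (suc n) (x k) _) ⟩
    sumR N (λ k → x k * (e ⋆ b k) n) ∎

  δ₀-⋆ : ∀ (a : Series) n → (δ₀ ⋆ a) n ≈ a n
  δ₀-⋆ a n = begin
    (δ₀ ⋆ a) n                                         ≈⟨ sumR-sucˡ n _ ⟩
    1# * a n + sumR n (λ i → 0# * a (n ∸ suc i))       ≈⟨ +-cong (*-identityˡ _) (sumR-zero n λ _ _ → zeroˡ _) ⟩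
    a n + 0#                                           ≈⟨ +-identityʳ _ ⟩
    a n ∎

  ⋆-shiftˡ : ∀ k (a b : Series) n → (shift k a ⋆ b) n ≈ shift k (a ⋆ b) n
  ⋆-shiftˡ zero    a b n       = refl
  ⋆-shiftˡ (suc k) a b zero    = trans (+-identityˡ _) (zeroˡ _)
  ⋆-shiftˡ (suc k) a b (suc n) = begin
    (shift (suc k) a ⋆ b) (suc n)    ≈⟨ sumR-sucˡ (suc n) _ ⟩
    0# * b (suc n) + (shift k a ⋆ b) n ≈⟨ trans (+-cong (zeroˡ _) refl) (+-identityˡ _) ⟩
    (shift k a ⋆ b) n                 ≈⟨ ⋆-shiftˡ k a b n ⟩
    shift k (a ⋆ b) n ∎

  ⋆-shiftʳ : ∀ k (a b : Series) n → (a ⋆ shift k b) n ≈ shift k (a ⋆ b) n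
  ⋆-shiftʳ zero    a b n       = refl
  ⋆-shiftʳ (suc k) a b zero    = trans (+-identityˡ _) (zeroʳ _)
  ⋆-shiftʳ (suc k) a b (suc n) = begin
    (a ⋆ b′) (suc n)                       ≈⟨ +-cong (sumR-cong (suc n) λ i i≤n →
                                                        *-congˡ (reflexive (≡.cong b′ (ℕ.+-∸-assoc 1 (ℕ.≤-pred i≤n)))))
                                                      (*-congˡ (reflexive (≡.cong b′ (ℕ.n∸n≡0 n)))) ⟩
    (a ⋆ shift k b) n + a (suc n) * 0#     ≈⟨ trans (+-cong refl (zeroʳ _)) (+-identityʳ _) ⟩
    (a ⋆ shift k b) n                      ≈⟨ ⋆-shiftʳ k a b n ⟩
    shift k (a ⋆ b) n ∎
    where b′ = shift (suc k) b

  ⋆-linearFactor : ∀ (a : Series) x (b : Series) n →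
                   ((λ i → a i + x * shift 1 a i) ⋆ b) n ≈ (a ⋆ (λ r → b r + x * shift 1 b r)) n
  ⋆-linearFactor a x b n = begin
    ((λ i → a i + x * shift 1 a i) ⋆ b) n   ≈⟨ ⋆-linearˡ a (shift 1 a) x b n ⟩
    (a ⋆ b) n + x * (shift 1 a ⋆ b) n       ≈⟨ +-cong refl (*-congˡ (⋆-shiftˡ 1 a b n)) ⟩
    (a ⋆ b) n + x * shift 1 (a ⋆ b) n       ≈⟨ +-cong refl (*-congˡ (⋆-shiftʳ 1 a b n)) ⟨
    (a ⋆ b) n + x * (a ⋆ shift 1 b) n       ≈⟨ ⋆-linearʳ a b x (shift 1 b) n ⟨
    (a ⋆ (λ r → b r + x * shift 1 b r)) n ∎

  ⋆-cancelˡ : ∀ (a : Series) → a 0 ≈ 1# → ∀ {b b' : Series} →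
              (∀ n → (a ⋆ b) n ≈ (a ⋆ b') n) → ∀ n → b n ≈ b' n
  ⋆-cancelˡ a a₀≈1 {b} {b'} a⋆b≈a⋆b' = <-rec _ step
    where
    unit-factor : ∀ x → a 0 * x ≈ x
    unit-factor x = trans (*-cong a₀≈1 refl) (*-identityˡ x)
    ∸-suc-< : ∀ {i n} → i < n → n ∸ suc i < n
    ∸-suc-< {i} {suc n} _ = s≤s (ℕ.m∸n≤m n i)
    step : ∀ n → (∀ {m} → m < n → b m ≈ b' m) → b n ≈ b' n
    step n ih = begin
      b n                     ≈⟨ unit-factor _ ⟨
      a 0 * b n               ≈⟨ ∙-cancelʳ tail _ _ (begin
         a 0 * b n + tail      ≈⟨ sumR-sucˡ n _ ⟨
         (a ⋆ b) n             ≈⟨ a⋆b≈a⋆b' n ⟩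
         (a ⋆ b') n            ≈⟨ sumR-sucˡ n _ ⟩
         a 0 * b' n + tail'    ≈⟨ +-cong refl (sumR-cong n λ i i<n → *-cong refl (ih (∸-suc-< i<n))) ⟨
         a 0 * b' n + tail     ∎) ⟩
      a 0 * b' n              ≈⟨ unit-factor _ ⟩
      b' n ∎
      where
      tail  = sumR n (λ i → a (suc i) * b  (n ∸ suc i))
      tail' = sumR n (λ i → a (suc i) * b' (n ∸ suc i))

  coeff-+P : ∀ p r n → coeff (p +P r) n ≈ coeff p n + coeff r n
  coeff-+P []      r       n       = sym (+-identityˡ _)
  coeff-+P (a ∷ p) []      n       = sym (+-identityʳ _)
  coeff-+P (a ∷ p) (b ∷ r) zero    = refl
  coeff-+P (a ∷ p) (b ∷ r) (suc n) = coeff-+P p r n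

  coeff-scaleP : ∀ a p n → coeff (scaleP a p) n ≈ a * coeff p n
  coeff-scaleP a []      n       = sym (zeroʳ a)
  coeff-scaleP a (b ∷ p) zero    = refl
  coeff-scaleP a (b ∷ p) (suc n) = coeff-scaleP a p n

  coeff-*P-linear : ∀ p b₀ b₁ n →
                    coeff (p *P (b₀ ∷ b₁ ∷ [])) n ≈ b₀ * coeff p n + b₁ * shift 1 (coeff p) n
  coeff-*P-linear []      b₀ b₁ zero    = sym (trans (+-cong (zeroʳ b₀) (zeroʳ b₁)) (+-identityʳ 0#))
  coeff-*P-linear []      b₀ b₁ (suc n) = sym (trans (+-cong (zeroʳ b₀) (zeroʳ b₁)) (+-identityʳ 0#))
  coeff-*P-linear (a ∷ p) b₀ b₁ n = begin
    coeff (scaleP a f +P (0# ∷ (p *P f))) n          ≈⟨ coeff-+P (scaleP a f) (0# ∷ (p *P f)) n ⟩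
    coeff (scaleP a f) n + coeff (0# ∷ (p *P f)) n   ≈⟨ +-cong (coeff-scaleP a f n) refl ⟩
    a * coeff f n + coeff (0# ∷ (p *P f)) n          ≈⟨ by-degree n ⟩
    b₀ * coeff (a ∷ p) n + b₁ * shift 1 (coeff (a ∷ p)) n ∎
    where
    f = b₀ ∷ b₁ ∷ []
    by-degree : ∀ n → a * coeff f n + coeff (0# ∷ (p *P f)) n
                      ≈ b₀ * coeff (a ∷ p) n + b₁ * shift 1 (coeff (a ∷ p)) n
    by-degree zero          = +-cong (*-comm a b₀) (sym (zeroʳ b₁))
    by-degree (suc zero)    = begin
      a * b₁ + coeff (p *P f) 0                 ≈⟨ +-cong (*-comm a b₁) (coeff-*P-linear p b₀ b₁ 0) ⟩
      b₁ * a + (b₀ * coeff p 0 + b₁ * 0#)       ≈⟨ +-comm _ _ ⟩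
      b₀ * coeff p 0 + b₁ * 0# + b₁ * a         ≈⟨ +-cong (trans (+-cong refl (zeroʳ b₁)) (+-identityʳ _)) refl ⟩
      b₀ * coeff p 0 + b₁ * a ∎
    by-degree (suc (suc n)) = trans (+-cong (zeroʳ a) (coeff-*P-linear p b₀ b₁ (suc n))) (+-identityˡ _)

  coeff-denom-zero : ∀ i → coeff (denom 0) i ≈ δ₀ i + (- 1#) * shift 1 δ₀ i
  coeff-denom-zero zero          = sym (trans (+-cong refl (zeroʳ _)) (+-identityʳ _))
  coeff-denom-zero (suc zero)    = sym (trans (+-identityˡ _) (*-identityʳ _))
  coeff-denom-zero (suc (suc i)) = sym (trans (+-identityˡ _) (zeroʳ _))

  coeff-denom-suc : ∀ d i → coeff (denom (suc d)) i
                            ≈ coeff (denom d) i + (- pow q (suc d)) * shift 1 (coeff (denom d)) i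
  coeff-denom-suc d i = trans (coeff-*P-linear (denom d) 1# _ i) (+-cong (*-identityˡ _) refl)

  coeff-denom-0≈1 : ∀ d → coeff (denom d) 0 ≈ 1#
  coeff-denom-0≈1 zero    = refl
  coeff-denom-0≈1 (suc d) = trans (coeff-denom-suc d 0) (trans (+-cong (coeff-denom-0≈1 d) (zeroʳ _)) (+-identityʳ _))

  qnat-suc : ∀ k → qnat (suc k) ≈ 1# + q * qnat k
  qnat-suc k = trans (sumR-sucˡ k (pow q)) (+-cong refl (sumR-*ˡ k q (pow q)))

  qnat-+ : ∀ a m → qnat (a ℕ.+ m) ≈ qnat a + pow q a * qnat m
  qnat-+ zero    m = sym (trans (+-identityˡ _) (*-identityˡ _))
  qnat-+ (suc a) m = begin
    qnat (suc (a ℕ.+ m))                         ≈⟨ qnat-suc (a ℕ.+ m) ⟩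
    1# + q * qnat (a ℕ.+ m)                      ≈⟨ +-cong refl (*-cong refl (qnat-+ a m)) ⟩
    1# + q * (qnat a + pow q a * qnat m)         ≈⟨ +-cong refl (distribˡ q _ _) ⟩
    1# + (q * qnat a + q * (pow q a * qnat m))   ≈⟨ +-assoc _ _ _ ⟨
    1# + q * qnat a + q * (pow q a * qnat m)     ≈⟨ +-cong (qnat-suc a) (*-assoc _ _ _) ⟨
    qnat (suc a) + pow q (suc a) * qnat m ∎

  rising : ℕ → Series
  rising d r = prodR d (λ i → qnat (r ℕ.+ suc i))

  rising-sucˡ : ∀ d r → rising (suc d) r ≈ qnat (suc r) * rising d (suc r)
  rising-sucˡ d r = trans (prodR-sucˡ d _)
    (*-cong (reflexive (≡.cong qnat (ℕ.+-comm r 1)))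
            (prodR-cong d λ i _ → reflexive (≡.cong qnat (ℕ.+-suc r (suc i)))))

  -- from [r+d+2] = [d+1] + q^(d+1) [r+1]
  rising-recurrence : ∀ d r → rising (suc d) r + (- pow q (suc d)) * shift 1 (rising (suc d)) r
                              ≈ qnat (suc d) * rising d r
  rising-recurrence d zero    = trans (+-cong refl (zeroʳ _)) (trans (+-identityʳ _) (*-comm _ _))
  rising-recurrence d (suc r) = begin
    P * qnat (suc r ℕ.+ suc d) + Q′ * rising (suc d) r
      ≈⟨ +-cong (*-cong refl (trans (reflexive (≡.cong qnat (ℕ.+-comm (suc r) (suc d))))
                                    (qnat-+ (suc d) (suc r))))
                (*-cong refl (rising-sucˡ d r)) ⟩
    P * (qnat (suc d) + Q * qnat (suc r)) + Q′ * (qnat (suc r) * P)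
      ≈⟨ +-cong (distribˡ P _ _) (sym (-‿distribˡ-* Q _)) ⟩
    P * qnat (suc d) + P * (Q * qnat (suc r)) + - (Q * (qnat (suc r) * P))
      ≈⟨ +-cong (+-cong (*-comm _ _) (x∙yz≈y∙xz P Q _)) (-‿cong (*-congˡ (*-comm _ _))) ⟩
    qnat (suc d) * P + Q * (P * qnat (suc r)) + - (Q * (P * qnat (suc r)))
      ≈⟨ +-assoc _ _ _ ⟩
    qnat (suc d) * P + (Q * (P * qnat (suc r)) + - (Q * (P * qnat (suc r))))
      ≈⟨ +-cong refl (-‿inverseʳ _) ⟩
    qnat (suc d) * P + 0#
      ≈⟨ +-identityʳ _ ⟩
    qnat (suc d) * P ∎
    where
    P  = rising d (suc r)
    Q  = pow q (suc d)
    Q′ = - pow q (suc d)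

  denom⋆rising : ∀ d n → (coeff (denom d) ⋆ rising d) n ≈ qfact d * δ₀ n
  denom⋆rising zero n = begin
    (coeff (denom 0) ⋆ rising 0) n
      ≈⟨ ⋆-cong {b = rising 0} coeff-denom-zero (λ _ → refl) n ⟩
    ((λ i → δ₀ i + (- 1#) * shift 1 δ₀ i) ⋆ rising 0) n
      ≈⟨ ⋆-linearFactor δ₀ (- 1#) (rising 0) n ⟩
    (δ₀ ⋆ (λ r → rising 0 r + (- 1#) * shift 1 (rising 0) r)) n
      ≈⟨ δ₀-⋆ (λ r → rising 0 r + (- 1#) * shift 1 (rising 0) r) n ⟩
    1# + (- 1#) * shift 1 (rising 0) n
      ≈⟨ telescope n ⟩
    1# * δ₀ n ∎
    where
    telescope : ∀ n → 1# + (- 1#) * shift 1 (rising 0) n ≈ 1# * δ₀ n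
    telescope zero    = trans (+-cong refl (zeroʳ _)) (trans (+-identityʳ 1#) (sym (*-identityʳ 1#)))
    telescope (suc n) = trans (+-cong refl (-1*x≈-x 1#)) (trans (-‿inverseʳ 1#) (sym (zeroʳ 1#)))
  denom⋆rising (suc d) n = begin
    (coeff (denom (suc d)) ⋆ rising (suc d)) n
      ≈⟨ ⋆-cong {b = rising (suc d)} (coeff-denom-suc d) (λ _ → refl) n ⟩
    ((λ i → e i + (- pow q (suc d)) * shift 1 e i) ⋆ rising (suc d)) n
      ≈⟨ ⋆-linearFactor e (- pow q (suc d)) (rising (suc d)) n ⟩
    (e ⋆ (λ r → rising (suc d) r + (- pow q (suc d)) * shift 1 (rising (suc d)) r)) n
      ≈⟨ ⋆-cong {a = e} (λ _ → refl) (rising-recurrence d) n ⟩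
    (e ⋆ (λ r → qnat (suc d) * rising d r)) n
      ≈⟨ ⋆-*ʳ e (qnat (suc d)) (rising d) n ⟩
    qnat (suc d) * (e ⋆ rising d) n
      ≈⟨ *-congˡ (denom⋆rising d n) ⟩
    qnat (suc d) * (qfact d * δ₀ n)
      ≈⟨ *-assoc _ _ _ ⟨
    qnat (suc d) * qfact d * δ₀ n
      ≈⟨ *-congʳ (*-comm _ _) ⟩
    qfact (suc d) * δ₀ n ∎
    where e = coeff (denom d)

  sumR-shift-δ₀-≥ : ∀ (h : ℕ → Carrier) N n → N ≤ n → sumR N (λ k → h k * shift k δ₀ n) ≈ 0#
  sumR-shift-δ₀-≥ h N n N≤n = sumR-zero N λ k k<N →
    trans (*-congˡ (reflexive (shift-δ₀-≢ (ℕ.>⇒≢ (ℕ.<-≤-trans k<N N≤n))))) (zeroʳ _)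

  sumR-shift-δ₀-< : ∀ (h : ℕ → Carrier) N n → n < N → sumR N (λ k → h k * shift k δ₀ n) ≈ h n
  sumR-shift-δ₀-< h (suc N) n (s≤s n≤N) with ℕ.m≤n⇒m<n∨m≡n n≤N
  ... | inj₁ n<N    = trans (+-cong (sumR-shift-δ₀-< h N n n<N)
                                    (trans (*-congˡ (reflexive (shift-δ₀-≢ (ℕ.<⇒≢ n<N)))) (zeroʳ _)))
                            (+-identityʳ _)
  ... | inj₂ ≡.refl = trans (+-cong (sumR-shift-δ₀-≥ h n n ℕ.≤-refl)
                                    (trans (*-congˡ (reflexive (shift-δ₀-diag n))) (*-identityʳ _)))
                            (+-identityˡ _)

  numCoeff≈sumR-shift-δ₀ : ∀ d h n → numCoeff d h n ≈ sumR (suc d) (λ k → h k * shift k δ₀ n)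
  numCoeff≈sumR-shift-δ₀ d h n with n ≤ᵇ d in n≤ᵇd
  ... | true  = sym (sumR-shift-δ₀-< h (suc d) n (s≤s (ℕ.≤ᵇ⇒≤ n d (≡.subst T (≡.sym n≤ᵇd) tt))))
  ... | false = sym (sumR-shift-δ₀-≥ h (suc d) n (ℕ.≰⇒> λ n≤d → ≡.subst T n≤ᵇd (ℕ.≤⇒≤ᵇ n≤d)))

  shiftedRising : ℕ → ℕ → Series
  shiftedRising d k n = prodR d (λ i → qint (suc i ⊖ k) + qpow (suc i ⊖ k) * qnat n)

  module _ (q*qinv≈1 : q * qinv ≈ 1#) where

    pow-inverse : ∀ n → pow q n * pow qinv n ≈ 1#
    pow-inverse zero    = *-identityˡ 1#
    pow-inverse (suc n) = begin
      q * pow q n * (qinv * pow qinv n)   ≈⟨ *-interchange q _ qinv _ ⟩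
      q * qinv * (pow q n * pow qinv n)   ≈⟨ *-cong q*qinv≈1 (pow-inverse n) ⟩
      1# * 1#                             ≈⟨ *-identityˡ 1# ⟩
      1# ∎

    pow-qinv-qnat : ∀ b → pow qinv b * qnat b ≈ sumR b (λ i → pow qinv (suc i))
    pow-qinv-qnat zero    = zeroʳ _
    pow-qinv-qnat (suc b) = begin
      qinv * pow qinv b * qnat (suc b)                           ≈⟨ *-congˡ (qnat-suc b) ⟩
      qinv * pow qinv b * (1# + q * qnat b)                      ≈⟨ distribˡ _ _ _ ⟩
      qinv * pow qinv b * 1# + qinv * pow qinv b * (q * qnat b)  ≈⟨ +-cong (*-identityʳ _) (*-interchange qinv _ q _) ⟩
      pow qinv (suc b) + qinv * q * (pow qinv b * qnat b)
        ≈⟨ +-cong refl (*-cong (trans (*-comm _ _) q*qinv≈1) (pow-qinv-qnat b)) ⟩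
      pow qinv (suc b) + 1# * sumR b (λ i → pow qinv (suc i))    ≈⟨ +-comm _ _ ⟩
      1# * sumR b (λ i → pow qinv (suc i)) + pow qinv (suc b)    ≈⟨ +-cong (*-identityˡ _) refl ⟩
      sumR (suc b) (λ i → pow qinv (suc i)) ∎

    qint-neg-+ : ∀ a r → qint (ℤ.- + a) + qpow (ℤ.- + a) * qnat (a ℕ.+ r) ≈ qnat r
    qint-neg-+ zero    r = trans (+-identityˡ _) (*-identityˡ _)
    qint-neg-+ (suc b) r = begin
      - S + Q′ * qnat (suc b ℕ.+ r)                        ≈⟨ +-cong refl (*-congˡ (qnat-+ (suc b) r)) ⟩
      - S + Q′ * (qnat (suc b) + pow q (suc b) * qnat r)   ≈⟨ +-cong refl (distribˡ _ _ _) ⟩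
      - S + (Q′ * qnat (suc b) + Q′ * (pow q (suc b) * qnat r))
        ≈⟨ +-cong refl (+-cong (pow-qinv-qnat (suc b)) (trans (sym (*-assoc _ _ _))
             (trans (*-cong (trans (*-comm _ _) (pow-inverse (suc b))) refl) (*-identityˡ _)))) ⟩
      - S + (S + qnat r)                                   ≈⟨ +-assoc _ _ _ ⟨
      - S + S + qnat r                                     ≈⟨ +-cong (-‿inverseˡ S) refl ⟩
      0# + qnat r                                          ≈⟨ +-identityˡ _ ⟩
      qnat r ∎
      where
      S  = sumR (suc b) (λ i → pow qinv (suc i))
      Q′ = pow qinv (suc b)

    qint-⊖-+ : ∀ r m → qint (r ⊖ m) + qpow (r ⊖ m) * qnat m ≈ qnat r
    qint-⊖-+ r m with m ≤? r
    ... | yes m≤r = begin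
      qint (r ⊖ m) + qpow (r ⊖ m) * qnat m   ≡⟨ ≡.cong (λ e → qint e + qpow e * qnat m) (ℤ.≤-⊖ m≤r) ⟩
      qnat (r ∸ m) + pow q (r ∸ m) * qnat m   ≈⟨ qnat-+ (r ∸ m) m ⟨
      qnat (r ∸ m ℕ.+ m)                      ≡⟨ ≡.cong qnat (ℕ.m∸n+n≡m m≤r) ⟩
      qnat r ∎
    ... | no m≰r = begin
      qint (r ⊖ m) + qpow (r ⊖ m) * qnat m
        ≡⟨ ≡.cong₂ (λ e k → qint e + qpow e * qnat k) (ℤ.⊖-≰ m≰r) (≡.sym (ℕ.m∸n+n≡m r≤m)) ⟩
      qint (ℤ.- + (m ∸ r)) + qpow (ℤ.- + (m ∸ r)) * qnat (m ∸ r ℕ.+ r)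
        ≈⟨ qint-neg-+ (m ∸ r) r ⟩
      qnat r ∎
      where r≤m = ℕ.<⇒≤ (ℕ.≰⇒> m≰r)

    qint-balanced : ∀ m j k r → m ℕ.+ j ≡ k ℕ.+ r → qint (j ⊖ k) + qpow (j ⊖ k) * qnat m ≈ qnat r
    qint-balanced m j k r eq =
      trans (reflexive (≡.cong (λ e → qint e + qpow e * qnat m) (⊖-balance {m} {j} {k} {r} eq))) (qint-⊖-+ r m)

    shiftedRising-+ : ∀ d k r → shiftedRising d k (k ℕ.+ r) ≈ rising d r
    shiftedRising-+ d k r = prodR-cong d λ i _ →
      qint-balanced (k ℕ.+ r) (suc i) k (r ℕ.+ suc i) (ℕ.+-assoc k r (suc i))

    shiftedRising-< : ∀ d {k n} → n < k → k ≤ d → shiftedRising d k n ≈ 0#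
    shiftedRising-< d {suc k} {n} (s≤s n≤k) 1+k≤d =
      prodR-zero d (k ∸ n) i<d (qint-balanced n (suc (k ∸ n)) (suc k) 0 n+[1+i]≡[1+k]+0)
      where
      i<d : k ∸ n < d
      i<d = ℕ.<-≤-trans (s≤s (ℕ.m∸n≤m k n)) 1+k≤d
      n+[1+i]≡[1+k]+0 : n ℕ.+ suc (k ∸ n) ≡ suc k ℕ.+ 0
      n+[1+i]≡[1+k]+0 =
        ≡.trans (ℕ.+-suc n (k ∸ n)) (≡.cong suc (≡.trans (ℕ.m+[n∸m]≡n n≤k) (≡.sym (ℕ.+-identityʳ k))))

    shiftedRising≈shift : ∀ d k n → k ≤ d → shiftedRising d k n ≈ shift k (rising d) n
    shiftedRising≈shift d k n k≤d with k ≤? n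
    ... | yes k≤n = begin
      shiftedRising d k n               ≡⟨ ≡.cong (shiftedRising d k) n≡k+r ⟩
      shiftedRising d k (k ℕ.+ r)       ≈⟨ shiftedRising-+ d k r ⟩
      rising d r                        ≡⟨ shift-+ k (rising d) r ⟨
      shift k (rising d) (k ℕ.+ r)      ≡⟨ ≡.cong (shift k (rising d)) n≡k+r ⟨
      shift k (rising d) n ∎
      where
      r = n ∸ k
      n≡k+r = ≡.sym (ℕ.m+[n∸m]≡n k≤n)
    ... | no k≰n = trans (shiftedRising-< d n<k k≤d) (reflexive (≡.sym (shift-< (rising d) n<k)))
      where n<k = ℕ.≰⇒> k≰n

    denom⋆shiftedRising : ∀ d fi → qfact d * fi ≈ 1# → ∀ k → k ≤ d → ∀ n →
      (coeff (denom d) ⋆ (λ r → shiftedRising d k r * fi)) n ≈ shift k δ₀ n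
    denom⋆shiftedRising d fi [d]!*fi≈1 k k≤d n = begin
      (e ⋆ (λ r → shiftedRising d k r * fi)) n
        ≈⟨ ⋆-cong {a = e} (λ _ → refl) (λ r → trans (*-comm _ fi) (*-congˡ (shiftedRising≈shift d k r k≤d))) n ⟩
      (e ⋆ (λ r → fi * shift k (rising d) r)) n   ≈⟨ ⋆-*ʳ e fi (shift k (rising d)) n ⟩
      fi * (e ⋆ shift k (rising d)) n             ≈⟨ *-congˡ (⋆-shiftʳ k e (rising d) n) ⟩
      fi * shift k (e ⋆ rising d) n               ≈⟨ *-congˡ (shift-*ˡ (qfact d) (denom⋆rising d) k n) ⟩
      fi * (qfact d * shift k δ₀ n)               ≈⟨ *-assoc _ _ _ ⟨
      fi * qfact d * shift k δ₀ n                 ≈⟨ *-congʳ (trans (*-comm _ _) [d]!*fi≈1) ⟩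
      1# * shift k δ₀ n                           ≈⟨ *-identityˡ _ ⟩
      shift k δ₀ n ∎
      where e = coeff (denom d)

    denom⋆solution : ∀ d fi → qfact d * fi ≈ 1# → ∀ h n →
      (coeff (denom d) ⋆ (λ r → sumR (suc d) (λ k → h k * (shiftedRising d k r * fi)))) n ≈ numCoeff d h n
    denom⋆solution d fi [d]!*fi≈1 h n = begin
      (coeff (denom d) ⋆ (λ r → sumR (suc d) (λ k → h k * (shiftedRising d k r * fi)))) n
        ≈⟨ ⋆-sumʳ (coeff (denom d)) (suc d) h (λ k r → shiftedRising d k r * fi) n ⟩
      sumR (suc d) (λ k → h k * (coeff (denom d) ⋆ (λ r → shiftedRising d k r * fi)) n)
        ≈⟨ sumR-cong (suc d) (λ k k<1+d → *-congˡ (denom⋆shiftedRising d fi [d]!*fi≈1 k (ℕ.≤-pred k<1+d) n)) ⟩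
      sumR (suc d) (λ k → h k * shift k δ₀ n)
        ≈⟨ numCoeff≈sumR-shift-δ₀ d h n ⟨
      numCoeff d h n ∎

mainTheorem19 : ∀ {c ℓ : Level} (R : CommutativeRing c ℓ) →
    let open CommutativeRing R in
    (q qinv : Carrier) → q * qinv ≈ 1# →
    let open QArith R q qinv in
    (d : ℕ) (fact-inv : Carrier) → qfact d * fact-inv ≈ 1# →
    (h Z : ℕ → Carrier) →
    (∀ n → seriesTimesPoly (denom d) Z n ≈ numCoeff d h n) →
    ∀ n → Z n ≈ sumR (suc d) (λ k → h k *
            (prodR d (λ i → qint (suc i ⊖ k)
                             + qpow (suc i ⊖ k) * qnat n)
             * fact-inv))
mainTheorem19 R q qinv q*qinv≈1 d fi [d]!*fi≈1 h Z denom⋆Z≈num =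
  ⋆-cancelˡ R q qinv (coeff (denom d)) (coeff-denom-0≈1 R q qinv d)
    λ n → trans (denom⋆Z≈num n) (sym (denom⋆solution R q qinv q*qinv≈1 d fi [d]!*fi≈1 h n))
  where
  open CommutativeRing R
  open QArith R q qinv
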